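{- Let $\vec k=(a,1,c)$ with positive integers $a$ and $c$. Then $\mathrm{depth}(\pi)=\mathrm{bounce}(\pi)$ for every $\pi\in\mathcal{D}_{\vec k}$, and hence $$\sum_{\pi\in\mathcal{D}_{\vec k}}q^{\mathrm{area}(\pi)}t^{\mathrm{depth}(\pi)}=\sum_{\pi\in\mathcal{D}_{\vec k}}q^{\mathrm{area}(\pi)}t^{\mathrm{bounce}(\pi)}.$$
   Context: For a vector $\vec{k}=(k_1,\dots,k_\ell)$ of positive integers, $N=|\vec k|+\ell$. A $\vec{k}$-Dyck path is a word $\pi=\pi_1\cdots\pi_N$ consisting of the letters $S^{k_1},\dots,S^{k_\ell}$, each exactly once and in this order from left to right, together with $|\vec k|$ letters $W$, such that the starting ranks $r_1=0$, $r_{i+1}=r_i+k_j$ if $\pi_i=S^{k_j}$, $r_{i+1}=r_i-1$ if $\pi_i=W$, are all nonnegative. $\mathcal{D}_{\vec k}$ is the set of $\vec k$-Dyck paths. The area sequence is $(a_1,\dots,a_\ell)$ with $a_j=r_i$ where $\pi_i=S^{k_j}$; $\mathrm{area}(\pi)=\sum_j a_j$. Filling algorithms: in a tableau of $\ell$ top-justified columns, column $i$ with $k_i+1$ cells, place $1,\dots,N$ successively: $1$ at the top of column 1; for $i\ge2$, if $\pi_i$ is an $S$-letter put $i$ at the top of the leftmost empty column, and if $\pi_i=W$ put $i$ immediately below an active entry (an entry is active if it is currently the bottom-most entry of its column $j$ and that column has fewer than $k_j+1$ entries). Choosing the smallest active entry each time gives $\eta(\pi)$; choosing the largest active entry each time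 gives $\eta_*(\pi)$. Ranking of a filled tableau: column 1 gets ranks $0,1,\dots,k_1$ top to bottom; for $i\ge2$, if the top entry of column $i$ is $A+1$ and $A$ has rank $\alpha$, column $i$ gets ranks $\alpha,\dots,\alpha+k_i$ top to bottom. $\mathrm{bounce}(\pi)$ is the sum of the ranks of the first-row cells of $\eta(\pi)$, and $\mathrm{depth}(\pi)$ is the sum of the ranks of the first-row cells of $\eta_*(\pi)$. -}

module Defs where

open import Data.Bool using (Bool; true; false; if_then_else_)
open import Data.Nat using (ℕ; zero; suc; _+_; _∸_; _<ᵇ_; _<_)
open import Data.List using (List; []; _∷_; _++_; length; map; filter; replicate)
open import Data.Nat.ListAction using (sum)
open import Data.List.Relation.Unary.All using (All; all?)
open import Data.Maybe using (Maybe; just; nothing; fromMaybe)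
open import Data.Product using (Σ; _×_; _,_; proj₁; proj₂)
open import Data.Integer as ℤ using (ℤ; +_; 0ℤ)
import Data.Integer.Properties as ℤP
import Data.Nat.Properties as ℕP
open import Relation.Binary.PropositionalEquality using (_≡_)
open import Relation.Nullary using (Dec)
open import Relation.Nullary.Decidable using (_×-dec_)

-- Words.  The j-th occurrence of the letter S stands for S^{k_j}
-- (the S-letters occur exactly once each and in order), W is W.

data Letter : Set where
  S W : Letter

Word : Set
Word = List Letter

countS : Word → ℕ
countS []      = 0
countS (S ∷ w) = suc (countS w)
countS (W ∷ w) = countS w

countW : Word → ℕ
countW []      = 0
countW (S ∷ w) = countW w
countW (W ∷ w) = suc (countW w)

ranksFrom : ℤ → List ℕ → Word → List ℤ
ranksFrom r ks       []      = []
ranksFrom r []       (S ∷ w) = r ∷ ranksFrom r [] w   -- surplus S: excluded by countS condition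
ranksFrom r (k ∷ ks) (S ∷ w) = r ∷ ranksFrom (r ℤ.+ + k) (ks) w
ranksFrom r ks       (W ∷ w) = r ∷ ranksFrom (r ℤ.- + 1) ks w

ranks : List ℕ → Word → List ℤ
ranks k w = ranksFrom 0ℤ k w

IsDyck : List ℕ → Word → Set
IsDyck k w = (countS w ≡ length k) × (countW w ≡ sum k) × All (0ℤ ℤ.≤_) (ranks k w)

isDyck? : (k : List ℕ) (w : Word) → Dec (IsDyck k w)
isDyck? k w = (countS w ℕP.≟ length k) ×-dec ((countW w ℕP.≟ sum k) ×-dec all? (0ℤ ℤP.≤?_) (ranks k w))

areaSeq : List ℕ → Word → List ℤ
areaSeq k w = go (ranks k w) w
  where
  go : List ℤ → Word → List ℤ
  go (r ∷ rs) (S ∷ w) = r ∷ go rs w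
  go (r ∷ rs) (W ∷ w) = go rs w
  go _        _       = []

sumℤ : List ℤ → ℤ
sumℤ []       = 0ℤ
sumℤ (x ∷ xs) = x ℤ.+ sumℤ xs

area : List ℕ → Word → ℤ
area k w = sumℤ (areaSeq k w)

-- Filling algorithms.  A (partial) tableau is a list of columns, the
-- j-th column listing its entries top to bottom; column j has k_j + 1 cells.

Cols : Set
Cols = List (List ℕ)

placeTop : ℕ → Cols → Cols
placeTop i []            = []
placeTop i ([] ∷ cs)     = (i ∷ []) ∷ cs
placeTop i ((x ∷ c) ∷ cs) = (x ∷ c) ∷ placeTop i cs

lastEntry : List ℕ → Maybe ℕ
lastEntry []       = nothing
lastEntry (x ∷ []) = just x
lastEntry (x ∷ y ∷ c) = lastEntry (y ∷ c)

-- active entries, as pairs (entry , column index (0-based))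
actives : ℕ → List ℕ → Cols → List (ℕ × ℕ)
actives j (k ∷ ks) (c ∷ cs) with lastEntry c | length c <ᵇ suc k
... | just e  | true  = (e , j) ∷ actives (suc j) ks cs
... | _       | _     = actives (suc j) ks cs
actives j _ _ = []

-- choose an active entry: `better x y` means x is preferred over y
choose : (ℕ → ℕ → Bool) → List (ℕ × ℕ) → Maybe (ℕ × ℕ)
choose better []       = nothing
choose better (p ∷ ps) with choose better ps
... | nothing = just p
... | just q  = if better (proj₁ p) (proj₁ q) then just p else just q

appendAt : ℕ → ℕ → Cols → Cols
appendAt i j       []       = []
appendAt i zero    (c ∷ cs) = (c ++ (i ∷ [])) ∷ cs
appendAt i (suc j) (c ∷ cs) = c ∷ appendAt i j cs

step : (ℕ → ℕ → Bool) → List ℕ → ℕ → Letter → Cols → Cols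
step better k i S cs = placeTop i cs
step better k i W cs with choose better (actives 0 k cs)
... | nothing      = cs
... | just (_ , j) = appendAt i j cs

fillFrom : (ℕ → ℕ → Bool) → List ℕ → ℕ → Word → Cols → Cols
fillFrom better k i []      cs = cs
fillFrom better k i (x ∷ w) cs = fillFrom better k (suc i) w (step better k i x cs)

fill : (ℕ → ℕ → Bool) → List ℕ → Word → Cols
fill better k w = fillFrom better k 1 w (replicate (length k) [])

smaller larger : ℕ → ℕ → Bool
smaller x y = x <ᵇ y
larger  x y = y <ᵇ x

η η* : List ℕ → Word → Cols
η  k w = fill smaller k w
η* k w = fill larger  k w

-- Ranking.  Column j's cells get ranks base_j, base_j + 1, ... top to
-- bottom, with base_1 = 0 and base_j = rank of (top_j - 1).

posIn : ℕ → List ℕ → Maybe ℕ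
posIn e []       = nothing
posIn e (x ∷ c)  with e Data.Nat.≟ x
... | Relation.Nullary.yes _ = just 0
... | Relation.Nullary.no  _ = Data.Maybe.map suc (posIn e c)

rankIn : ℕ → List (ℕ × List ℕ) → Maybe ℕ
rankIn e []             = nothing
rankIn e ((b , c) ∷ ds) with posIn e c
... | just p  = just (b + p)
... | nothing = rankIn e ds

baseOf : List (ℕ × List ℕ) → List ℕ → ℕ
baseOf []          _       = 0
baseOf (d ∷ ds)    []      = 0                       -- (empty column; does not occur)
baseOf (d ∷ ds)    (x ∷ c) = fromMaybe 0 (rankIn (x ∸ 1) (d ∷ ds))

firstRowRanks : Cols → List ℕ
firstRowRanks = go []
  where
  go : List (ℕ × List ℕ) → Cols → List ℕ
  go done []       = []
  go done (c ∷ cs) = baseOf done c ∷ go (done ++ ((baseOf done c , c) ∷ [])) cs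

bounce depth : List ℕ → Word → ℕ
bounce k w = sum (firstRowRanks (η  k w))
depth  k w = sum (firstRowRanks (η* k w))

-- Enumeration of D_k and the generating functions, represented as the
-- list of monomials q^{area} t^{stat}, one per path (in a fixed order).

allWords : ℕ → List Word
allWords zero    = [] ∷ []
allWords (suc n) = map (S ∷_) (allWords n) ++ map (W ∷_) (allWords n)

dyckPaths : List ℕ → List Word
dyckPaths k = filter (isDyck? k) (allWords (sum k + length k))

gfDepth gfBounce : List ℕ → List (ℤ × ℕ)
gfDepth  k = map (λ π → (area k π , depth  k π)) (dyckPaths k)
gfBounce k = map (λ π → (area k π , bounce k π)) (dyckPaths k)

{-# OPTIONS --safe #-}
module Submission where

-- Write π = S^a W^i S W^j S^c ρ.  The first-row ranks of η(π) and η_*(π) are 0, i and the rank of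
-- the entry 2+i+j.  Reading ρ cannot change them: all later entries exceed 3+i+j and are only ever
-- placed below existing ones, so the entries up to 2+i+j keep their positions.  While W^j is read
-- (and column 1 still has room), η puts 3+i below 1+i and 4+i below 2+i, whereas η_* puts 3+i below
-- 2+i and 4+i below 1+i.  Both 1+i and 2+i have rank i, so 3+i and 4+i get rank i+1 in either
-- filling, and every later W goes to column 1 with the same rank in both.

open import Defs
open import Data.Bool using (Bool; true; false)
open import Data.Bool.Properties using (T-≡)
open import Data.Integer as ℤ using (ℤ; 0ℤ)
open import Data.List using (List; []; _∷_; _++_; length; replicate)
open import Data.List.Properties using (++-assoc; ++-identityʳ; length-++; length-replicate; map-cong-local)
open import Data.List.Relation.Unary.All as All using (All; []; _∷_)
open import Data.List.Relation.Unary.All.Properties using (++⁺; all-filter)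
open import Data.Maybe as Maybe using (Maybe; just; nothing; fromMaybe)
open import Data.Nat using (ℕ; zero; suc; _+_; _∸_; _<_; _≤_; _<ᵇ_; _≟_; _<?_; pred; z≤n; s≤s; z<s)
open import Data.Nat.ListAction using (sum)
open import Data.Nat.Properties
open import Data.Product using (∃-syntax; _×_; _,_; proj₁; proj₂)
open import Data.Sum using (inj₁; inj₂)
open import Function using (_∘_)
open import Function.Bundles using (Equivalence)
open import Relation.Binary.PropositionalEquality
open import Relation.Nullary using (yes; no; contradiction)

m+1+n≤1+o⇒m+n≤o : ∀ m {n o} → m + suc n ≤ suc o → m + n ≤ o
m+1+n≤1+o⇒m+n≤o m {n} {o} le = ≤-pred (subst (_≤ suc o) (+-suc m n) le)

m+1+n≤o⇒m<o : ∀ m {n o} → m + suc n ≤ o → m < o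
m+1+n≤o⇒m<o m {n} {o} le = m+n≤o⇒m≤o (suc m) (subst (_≤ o) (+-suc m n) le)

m+1+n≤1+o⇒m≤o : ∀ m {n o} → m + suc n ≤ suc o → m ≤ o
m+1+n≤1+o⇒m≤o m = m+n≤o⇒m≤o m ∘ m+1+n≤1+o⇒m+n≤o m

m+2+n≤1+o⇒m<o : ∀ m {n o} → m + suc (suc n) ≤ suc o → m < o
m+2+n≤1+o⇒m<o m = m+1+n≤o⇒m<o m ∘ m+1+n≤1+o⇒m+n≤o m

<⇒<ᵇ≡true : ∀ {m n} → m < n → (m <ᵇ n) ≡ true
<⇒<ᵇ≡true = Equivalence.to T-≡ ∘ <⇒<ᵇ

≤⇒<ᵇ≡false : ∀ {m n} → n ≤ m → (m <ᵇ n) ≡ false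
≤⇒<ᵇ≡false {m} {n} n≤m with m <ᵇ n in m<ᵇn
... | false = refl
... | true  = contradiction n≤m (<⇒≱ (<ᵇ⇒< m n (Equivalence.from T-≡ m<ᵇn)))

range : ℕ → ℕ → List ℕ
range s zero    = []
range s (suc n) = s ∷ range (suc s) n

length-range : ∀ s n → length (range s n) ≡ n
length-range s zero    = refl
length-range s (suc n) = cong suc (length-range (suc s) n)

range-∌ : ∀ {x} s n → s + n ≤ x → All (x ≢_) (range s n)
range-∌     s zero    _        = []
range-∌ {x} s (suc n) s+1+n≤x =
  >⇒≢ (m+1+n≤o⇒m<o s s+1+n≤x) ∷ range-∌ (suc s) n (subst (_≤ x) (+-suc s n) s+1+n≤x)

lastEntry-range : ∀ s n → lastEntry (range s (suc n)) ≡ just (s + n)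
lastEntry-range s zero    = cong just (sym (+-identityʳ s))
lastEntry-range s (suc n) = trans (lastEntry-range (suc s) n) (cong just (sym (+-suc s n)))

lastEntry-snoc : ∀ c x → lastEntry (c ++ x ∷ []) ≡ just x
lastEntry-snoc []          x = refl
lastEntry-snoc (y ∷ [])    x = refl
lastEntry-snoc (y ∷ z ∷ c) x = lastEntry-snoc (z ∷ c) x

lastEntry-∷ : ∀ x c → ∃[ e ] lastEntry (x ∷ c) ≡ just e
lastEntry-∷ x []      = x , refl
lastEntry-∷ x (y ∷ c) = lastEntry-∷ y c

posIn-≡ : ∀ x c → posIn x (x ∷ c) ≡ just 0
posIn-≡ x c rewrite ≟-diag {x} refl = refl

posIn-≢ : ∀ {x y} c → x ≢ y → posIn x (y ∷ c) ≡ Maybe.map suc (posIn x c)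
posIn-≢ {x} {y} c x≢y with x ≟ y
... | yes x≡y = contradiction x≡y x≢y
... | no  _   = refl

posIn-∉ : ∀ {x} c → All (x ≢_) c → posIn x c ≡ nothing
posIn-∉ []      []          = refl
posIn-∉ (y ∷ c) (x≢y ∷ x∉c) = trans (posIn-≢ c x≢y) (cong (Maybe.map suc) (posIn-∉ c x∉c))

posIn-range : ∀ {x} s {n m} → m < n → x ≡ s + m → posIn x (range s n) ≡ just m
posIn-range {x} s {suc n} {zero}  _         x≡s+0 rewrite x≡s+0 | +-identityʳ s = posIn-≡ s (range (suc s) n)
posIn-range {x} s {suc n} {suc m} (s≤s m<n) x≡s+1+m =
  trans (posIn-≢ (range (suc s) n) x≢s) (cong (Maybe.map suc) (posIn-range (suc s) m<n (trans x≡s+1+m (+-suc s m))))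
  where
  x≢s : x ≢ s
  x≢s = >⇒≢ (subst (s <_) (sym x≡s+1+m) (m<m+n s z<s))

posIn-++-∈ˡ : ∀ {x m} c e → posIn x c ≡ just m → posIn x (c ++ e) ≡ just m
posIn-++-∈ˡ {x} (y ∷ c) e x∈c with x ≟ y
... | yes _ = x∈c
... | no  _ with posIn x c in x∈c′
...   | just _ = trans (cong (Maybe.map suc) (posIn-++-∈ˡ c e x∈c′)) x∈c

posIn-++-∉ˡ : ∀ {x m} c e → All (x ≢_) c → posIn x e ≡ just m → posIn x (c ++ e) ≡ just (length c + m)
posIn-++-∉ˡ []      e []          x∈e = x∈e
posIn-++-∉ˡ (y ∷ c) e (x≢y ∷ x∉c) x∈e =
  trans (posIn-≢ (c ++ e) x≢y) (cong (Maybe.map suc) (posIn-++-∉ˡ c e x∉c x∈e))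

posIn-++-∉ʳ : ∀ {x} c e → posIn x e ≡ nothing → posIn x (c ++ e) ≡ posIn x c
posIn-++-∉ʳ     []      e x∉e = x∉e
posIn-++-∉ʳ {x} (y ∷ c) e x∉e with x ≟ y
... | yes _ = refl
... | no  _ = cong (Maybe.map suc) (posIn-++-∉ʳ c e x∉e)

posIn-++-≥ : ∀ {B x} c e → x < B → All (B ≤_) e → posIn x (c ++ e) ≡ posIn x c
posIn-++-≥ c e x<B B≤e = posIn-++-∉ʳ c e (posIn-∉ e (All.map (λ B≤y → <⇒≢ (<-≤-trans x<B B≤y)) B≤e))

rankIn-here : ∀ x b c ds {m} → posIn x c ≡ just m → rankIn x ((b , c) ∷ ds) ≡ just (b + m)
rankIn-here x b c ds x∈c rewrite x∈c = refl

rankIn-there : ∀ x b c ds → posIn x c ≡ nothing → rankIn x ((b , c) ∷ ds) ≡ rankIn x ds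
rankIn-there x b c ds x∉c rewrite x∉c = refl

rankIn-++-≥ : ∀ {B x} b c e ds → x < B → All (B ≤_) e →
  rankIn x ((b , c ++ e) ∷ ds) ≡ rankIn x ((b , c) ∷ ds)
rankIn-++-≥ b c e ds x<B B≤e rewrite posIn-++-≥ c e x<B B≤e = refl

rankIn-cong-tail : ∀ x b c {ds ds′} → rankIn x ds′ ≡ rankIn x ds →
  rankIn x ((b , c) ∷ ds′) ≡ rankIn x ((b , c) ∷ ds)
rankIn-cong-tail x b c eq with posIn x c
... | just _  = refl
... | nothing = eq

firstRowRanks-three : ∀ x₁ c₁ x₂ c₂ x₃ c₃ {u} → rankIn (x₂ ∸ 1) ((0 , x₁ ∷ c₁) ∷ []) ≡ just u →
  firstRowRanks ((x₁ ∷ c₁) ∷ (x₂ ∷ c₂) ∷ (x₃ ∷ c₃) ∷ [])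
    ≡ 0 ∷ u ∷ fromMaybe 0 (rankIn (x₃ ∸ 1) ((0 , x₁ ∷ c₁) ∷ (u , x₂ ∷ c₂) ∷ [])) ∷ []
firstRowRanks-three x₁ c₁ x₂ c₂ x₃ c₃ rank₂ rewrite rank₂ = refl

data Extends (B : ℕ) : Cols → Cols → Set where
  []  : Extends B [] []
  _∷_ : ∀ {x c e cs cs′} → All (B ≤_) e → Extends B cs cs′ → Extends B ((x ∷ c) ∷ cs) ((x ∷ c ++ e) ∷ cs′)

extends-by-nothing : ∀ {B x c cs cs′} → Extends B cs cs′ → Extends B ((x ∷ c) ∷ cs) ((x ∷ c) ∷ cs′)
extends-by-nothing {B} {x} {c} {cs} {cs′} ext =
  subst (λ c′ → Extends B ((x ∷ c) ∷ cs) ((x ∷ c′) ∷ cs′)) (++-identityʳ c) ([] ∷ ext)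

placeTop-Extends : ∀ {B cs₀ cs} s → Extends B cs₀ cs → placeTop s cs ≡ cs
placeTop-Extends s []        = refl
placeTop-Extends s (_ ∷ ext) = cong (_ ∷_) (placeTop-Extends s ext)

appendAt-Extends : ∀ {B cs₀ cs} s j → B ≤ s → Extends B cs₀ cs → Extends B cs₀ (appendAt s j cs)
appendAt-Extends     s j       B≤s []  = []
appendAt-Extends {B} s zero    B≤s (_∷_ {x} {c} {e} {cs} {cs′} B≤e ext) =
  subst (λ c′ → Extends B ((x ∷ c) ∷ cs) ((x ∷ c′) ∷ cs′)) (sym (++-assoc c e (s ∷ [])))
        (++⁺ B≤e (B≤s ∷ []) ∷ ext)
appendAt-Extends     s (suc j) B≤s (B≤e ∷ ext) = B≤e ∷ appendAt-Extends s j B≤s ext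

step-Extends : ∀ {B cs₀ cs} b k s l → B ≤ s → Extends B cs₀ cs → Extends B cs₀ (step b k s l cs)
step-Extends           b k s S B≤s ext rewrite placeTop-Extends s ext = ext
step-Extends {cs = cs} b k s W B≤s ext with choose b (actives 0 k cs)
... | nothing      = ext
... | just (_ , j) = appendAt-Extends s j B≤s ext

fillFrom-Extends : ∀ {B cs₀ cs} b k s w → B ≤ s → Extends B cs₀ cs → Extends B cs₀ (fillFrom b k s w cs)
fillFrom-Extends b k s []      B≤s ext = ext
fillFrom-Extends b k s (l ∷ w) B≤s ext =
  fillFrom-Extends b k (suc s) w (m≤n⇒m≤1+n B≤s) (step-Extends b k s l B≤s ext)

firstRowRanks-Extends : ∀ {B x₁ c₁ x₂ c₂ x₃ c₃ cs′} → x₂ ∸ 1 < B → x₃ ∸ 1 < B →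
  Extends B ((x₁ ∷ c₁) ∷ (x₂ ∷ c₂) ∷ (x₃ ∷ c₃) ∷ []) cs′ →
  firstRowRanks cs′ ≡ firstRowRanks ((x₁ ∷ c₁) ∷ (x₂ ∷ c₂) ∷ (x₃ ∷ c₃) ∷ [])
firstRowRanks-Extends {x₁ = x₁} {c₁} {x₂} {c₂} {x₃} h₂ h₃
                      (_∷_ {e = e₁} B≤e₁ (_∷_ {e = e₂} B≤e₂ (_ ∷ []))) =
  cong₂ (λ r₂ r₃ → 0 ∷ fromMaybe 0 r₂ ∷ fromMaybe 0 r₃ ∷ []) rank₂ rank₃
  where
  column₂ : Maybe ℕ → List ℕ → List (ℕ × List ℕ)
  column₂ r₂ c₂′ = (fromMaybe 0 r₂ , x₂ ∷ c₂′) ∷ []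
  rank₂ : rankIn (x₂ ∸ 1) ((0 , x₁ ∷ c₁ ++ e₁) ∷ []) ≡ rankIn (x₂ ∸ 1) ((0 , x₁ ∷ c₁) ∷ [])
  rank₂ = rankIn-++-≥ 0 (x₁ ∷ c₁) e₁ [] h₂ B≤e₁
  rank₃ : rankIn (x₃ ∸ 1) ((0 , x₁ ∷ c₁ ++ e₁) ∷
                           column₂ (rankIn (x₂ ∸ 1) ((0 , x₁ ∷ c₁ ++ e₁) ∷ [])) (c₂ ++ e₂))
        ≡ rankIn (x₃ ∸ 1) ((0 , x₁ ∷ c₁) ∷ column₂ (rankIn (x₂ ∸ 1) ((0 , x₁ ∷ c₁) ∷ [])) c₂)
  rank₃ = trans (rankIn-++-≥ 0 (x₁ ∷ c₁) e₁ _ h₃ B≤e₁)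
         (trans (rankIn-cong-tail (x₃ ∸ 1) 0 (x₁ ∷ c₁) (rankIn-++-≥ _ (x₂ ∷ c₂) e₂ [] h₃ B≤e₂))
                (cong (λ r₂ → rankIn (x₃ ∸ 1) ((0 , x₁ ∷ c₁) ∷ column₂ r₂ c₂)) rank₂))

actives-room : ∀ j k ks c cs {e} → lastEntry c ≡ just e → length c ≤ k →
  actives j (k ∷ ks) (c ∷ cs) ≡ (e , j) ∷ actives (suc j) ks cs
actives-room j k ks c cs last≡e room rewrite last≡e | <⇒<ᵇ≡true (s≤s room) = refl

actives-full : ∀ j k ks c cs → suc k ≤ length c → actives j (k ∷ ks) (c ∷ cs) ≡ actives (suc j) ks cs
actives-full j k ks c cs full rewrite ≤⇒<ᵇ≡false full with lastEntry c
... | just _  = refl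
... | nothing = refl

choose-pair-true : ∀ b (p q : ℕ × ℕ) → b (proj₁ p) (proj₁ q) ≡ true → choose b (p ∷ q ∷ []) ≡ just p
choose-pair-true b p q p≺q rewrite p≺q = refl

choose-pair-false : ∀ b (p q : ℕ × ℕ) → b (proj₁ p) (proj₁ q) ≡ false → choose b (p ∷ q ∷ []) ≡ just q
choose-pair-false b p q p⊀q rewrite p⊀q = refl

step-W : ∀ b k s cs {e j} → choose b (actives 0 k cs) ≡ just (e , j) → step b k s W cs ≡ appendAt s j cs
step-W b k s cs chosen rewrite chosen = refl

fillFrom-++ : ∀ b k s u v cs → fillFrom b k s (u ++ v) cs ≡ fillFrom b k (s + length u) v (fillFrom b k s u cs)
fillFrom-++ b k s []      v cs rewrite +-identityʳ s = refl
fillFrom-++ b k s (l ∷ u) v cs rewrite +-suc s (length u) = fillFrom-++ b k (suc s) u v (step b k s l cs)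

fillFrom-Ws-first-column : ∀ b k ks s r x X cs → actives 1 ks cs ≡ [] → length X + r ≤ k →
  fillFrom b (k ∷ ks) s (replicate r W) ((x ∷ X) ∷ cs) ≡ ((x ∷ X) ++ range s r) ∷ cs
fillFrom-Ws-first-column b k ks s zero    x X cs _    _    = cong (λ c → (x ∷ c) ∷ cs) (sym (++-identityʳ X))
fillFrom-Ws-first-column b k ks s (suc r) x X cs none room = begin
  fillFrom b (k ∷ ks) (suc s) (replicate r W) (step b (k ∷ ks) s W ((x ∷ X) ∷ cs))
    ≡⟨ cong (fillFrom b (k ∷ ks) (suc s) (replicate r W)) appended ⟩
  fillFrom b (k ∷ ks) (suc s) (replicate r W) ((x ∷ X ++ s ∷ []) ∷ cs)
    ≡⟨ fillFrom-Ws-first-column b k ks (suc s) r x (X ++ s ∷ []) cs none room′ ⟩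
  (x ∷ (X ++ s ∷ []) ++ range (suc s) r) ∷ cs
    ≡⟨ cong (λ c → (x ∷ c) ∷ cs) (++-assoc X (s ∷ []) (range (suc s) r)) ⟩
  (x ∷ X ++ range s (suc r)) ∷ cs ∎
  where
  open ≡-Reasoning
  room′ : length (X ++ s ∷ []) + r ≤ k
  room′ = subst (_≤ k) (sym (trans (cong (_+ r) (length-++ X)) (+-assoc (length X) 1 r))) room
  appended : step b (k ∷ ks) s W ((x ∷ X) ∷ cs) ≡ (x ∷ X ++ s ∷ []) ∷ cs
  appended = step-W b (k ∷ ks) s ((x ∷ X) ∷ cs)
    (trans (cong (choose b) (actives-room 0 k ks (x ∷ X) cs (proj₂ (lastEntry-∷ x X))
                                          (m+1+n≤o⇒m<o (length X) room)))
           (cong (λ ps → choose b (_ ∷ ps)) none))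

module _ (b : ℕ → ℕ → Bool) (k c s x : ℕ) (X : List ℕ) (y : ℕ) where

  step-W-into-first : ∀ {e} → lastEntry (x ∷ X) ≡ just e → length X < k → b e y ≡ true →
    step b (k ∷ 1 ∷ c ∷ []) s W ((x ∷ X) ∷ (y ∷ []) ∷ [] ∷ []) ≡ ((x ∷ X) ++ s ∷ []) ∷ (y ∷ []) ∷ [] ∷ []
  step-W-into-first last≡e room e≺y = step-W b (k ∷ 1 ∷ c ∷ []) s ((x ∷ X) ∷ (y ∷ []) ∷ [] ∷ [])
    (trans (cong (choose b) (actives-room 0 k (1 ∷ c ∷ []) (x ∷ X) ((y ∷ []) ∷ [] ∷ []) last≡e room))
           (choose-pair-true b _ (y , 1) e≺y))

  step-W-into-second-full : k ≤ length X →
    step b (k ∷ 1 ∷ c ∷ []) s W ((x ∷ X) ∷ (y ∷ []) ∷ [] ∷ []) ≡ (x ∷ X) ∷ (y ∷ s ∷ []) ∷ [] ∷ []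
  step-W-into-second-full full = step-W b (k ∷ 1 ∷ c ∷ []) s ((x ∷ X) ∷ (y ∷ []) ∷ [] ∷ [])
    (cong (choose b) (actives-full 0 k (1 ∷ c ∷ []) (x ∷ X) ((y ∷ []) ∷ [] ∷ []) (s≤s full)))

  step-W-into-second : ∀ {e} → lastEntry (x ∷ X) ≡ just e → b e y ≡ false →
    step b (k ∷ 1 ∷ c ∷ []) s W ((x ∷ X) ∷ (y ∷ []) ∷ [] ∷ []) ≡ (x ∷ X) ∷ (y ∷ s ∷ []) ∷ [] ∷ []
  step-W-into-second last≡e e⊀y with length X <? k
  ... | yes room = step-W b (k ∷ 1 ∷ c ∷ []) s ((x ∷ X) ∷ (y ∷ []) ∷ [] ∷ [])
    (trans (cong (choose b) (actives-room 0 k (1 ∷ c ∷ []) (x ∷ X) ((y ∷ []) ∷ [] ∷ []) last≡e room))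
           (choose-pair-false b _ (y , 1) e⊀y))
  ... | no  full = step-W-into-second-full (≮⇒≥ full)

NonNegative : List ℤ → Set
NonNegative = All (0ℤ ℤ.≤_)

ranksFrom-head : ∀ {P : ℤ → Set} r ks l w → All P (ranksFrom r ks (l ∷ w)) → P r
ranksFrom-head r []      S w (Pr ∷ _) = Pr
ranksFrom-head r (_ ∷ _) S w (Pr ∷ _) = Pr
ranksFrom-head r []      W w (Pr ∷ _) = Pr
ranksFrom-head r (_ ∷ _) W w (Pr ∷ _) = Pr

split-before-S : ∀ r k ks n w → countS w ≡ suc n → NonNegative (ranksFrom (ℤ.+ r) (k ∷ ks) w) →
  ∃[ i ] ∃[ u ] w ≡ replicate i W ++ S ∷ u × i ≤ r × countS u ≡ n
                × NonNegative (ranksFrom (ℤ.+ (r ∸ i + k)) ks u)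
split-before-S r       k ks n []          ()
split-before-S zero    k ks n (W ∷ [])    ()
split-before-S r       k ks n (S ∷ u)     refl (_ ∷ ranks≥0) = 0 , u , refl , z≤n , refl , ranks≥0
split-before-S zero    k ks n (W ∷ l ∷ w) #S   (_ ∷ ranks≥0) with ranksFrom-head _ (k ∷ ks) l w ranks≥0
... | ()
split-before-S (suc r) k ks n (W ∷ w)     #S   (_ ∷ ranks≥0) with split-before-S r k ks n w #S ranks≥0
... | i , u , refl , i≤r , #S-u , ranks-u≥0 = suc i , u , refl , s≤s i≤r , #S-u , ranks-u≥0

module Vector-a-1-c (a c : ℕ) where

  K : List ℕ
  K = a ∷ 1 ∷ c ∷ []

  path : ℕ → ℕ → Word → Word
  path i j ρ = S ∷ replicate i W ++ S ∷ replicate j W ++ S ∷ ρ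

  IsDyck⇒path : ∀ π → IsDyck K π → ∃[ i ] ∃[ j ] ∃[ ρ ] π ≡ path i j ρ × i ≤ a × i + j ≤ suc a
  IsDyck⇒path π (#S , _ , ranks≥0) with split-before-S 0 a (1 ∷ c ∷ []) 2 π #S ranks≥0
  ... | 0 , π₁ , refl , z≤n , #S₁ , ranks₁≥0 with split-before-S a 1 (c ∷ []) 1 π₁ #S₁ ranks₁≥0
  ... | i , π₂ , refl , i≤a , #S₂ , ranks₂≥0 with split-before-S (a ∸ i + 1) c [] 0 π₂ #S₂ ranks₂≥0
  ... | j , ρ , refl , j≤a∸i+1 , _ , _ = i , j , ρ , refl , i≤a , i+j≤1+a
    where
    i+j≤1+a : i + j ≤ suc a
    i+j≤1+a = begin
      i + j           ≤⟨ +-monoʳ-≤ i j≤a∸i+1 ⟩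
      i + (a ∸ i + 1) ≡⟨ sym (+-assoc i (a ∸ i) 1) ⟩
      i + (a ∸ i) + 1 ≡⟨ cong (_+ 1) (m+[n∸m]≡n i≤a) ⟩
      a + 1           ≡⟨ +-comm a 1 ⟩
      suc a           ∎
      where open ≤-Reasoning

  afterSecondS : ℕ → Cols
  afterSecondS i = (1 ∷ range 2 i) ∷ (2 + i ∷ []) ∷ [] ∷ []

  firstRowRanks-fill : ∀ b i j ρ X Y → i ≤ a →
    fillFrom b K (3 + i) (replicate j W) (afterSecondS i) ≡ (1 ∷ X) ∷ (2 + i ∷ Y) ∷ [] ∷ [] →
    firstRowRanks (fill b K (path i j ρ)) ≡ firstRowRanks ((1 ∷ X) ∷ (2 + i ∷ Y) ∷ (3 + i + j ∷ []) ∷ [])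
  firstRowRanks-fill b i j ρ X Y i≤a afterWs = begin
    firstRowRanks (fillFrom b K 2 (replicate i W ++ S ∷ replicate j W ++ S ∷ ρ) ((1 ∷ []) ∷ [] ∷ [] ∷ []))
      ≡⟨ cong firstRowRanks (fillFrom-++ b K 2 (replicate i W) _ _) ⟩
    firstRowRanks (fillFrom b K (2 + length (replicate i W)) (S ∷ replicate j W ++ S ∷ ρ)
                             (fillFrom b K 2 (replicate i W) ((1 ∷ []) ∷ [] ∷ [] ∷ [])))
      ≡⟨ cong₂ (λ s cs → firstRowRanks (fillFrom b K s (S ∷ replicate j W ++ S ∷ ρ) cs))
               (cong (2 +_) (length-replicate i))
               (fillFrom-Ws-first-column b a (1 ∷ c ∷ []) 2 i 1 [] ([] ∷ [] ∷ []) refl i≤a) ⟩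
    firstRowRanks (fillFrom b K (3 + i) (replicate j W ++ S ∷ ρ) (afterSecondS i))
      ≡⟨ cong firstRowRanks (fillFrom-++ b K (3 + i) (replicate j W) _ _) ⟩
    firstRowRanks (fillFrom b K (3 + i + length (replicate j W)) (S ∷ ρ)
                             (fillFrom b K (3 + i) (replicate j W) (afterSecondS i)))
      ≡⟨ cong₂ (λ s cs → firstRowRanks (fillFrom b K s (S ∷ ρ) cs))
               (cong ((3 + i) +_) (length-replicate j)) afterWs ⟩
    firstRowRanks (fillFrom b K (4 + i + j) ρ ((1 ∷ X) ∷ (2 + i ∷ Y) ∷ (3 + i + j ∷ []) ∷ []))
      ≡⟨ firstRowRanks-Extends (s≤s (≤-trans (m≤m+n (suc i) j) (≤-trans (n≤1+n _) (n≤1+n _)))) (n≤1+n _)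
           (fillFrom-Extends b K (4 + i + j) ρ ≤-refl
             (extends-by-nothing (extends-by-nothing (extends-by-nothing [])))) ⟩
    firstRowRanks ((1 ∷ X) ∷ (2 + i ∷ Y) ∷ (3 + i + j ∷ []) ∷ []) ∎
    where open ≡-Reasoning

  fillFrom-W-full-first-column : ∀ b →
    fillFrom b K (3 + a) (W ∷ []) (afterSecondS a) ≡ (1 ∷ range 2 a) ∷ (2 + a ∷ 3 + a ∷ []) ∷ [] ∷ []
  fillFrom-W-full-first-column b =
    step-W-into-second-full b a c (3 + a) 1 (range 2 a) (2 + a) (≤-reflexive (sym (length-range 2 a)))

  fillFrom-larger-Ws : ∀ i j → i + suc j ≤ suc a →
    fillFrom larger K (3 + i) (replicate (suc j) W) (afterSecondS i)
      ≡ (1 ∷ range 2 i ++ range (4 + i) j) ∷ (2 + i ∷ 3 + i ∷ []) ∷ [] ∷ []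
  fillFrom-larger-Ws i j room = trans
    (cong (fillFrom larger K (4 + i) (replicate j W))
          (step-W-into-second larger a c (3 + i) 1 (range 2 i) (2 + i) (lastEntry-range 1 i)
                              (≤⇒<ᵇ≡false (n≤1+n (suc i)))))
    (fillFrom-Ws-first-column larger a (1 ∷ c ∷ []) (4 + i) j 1 (range 2 i) ((2 + i ∷ 3 + i ∷ []) ∷ [] ∷ []) refl
      (subst (_≤ a) (cong (_+ j) (sym (length-range 2 i))) (m+1+n≤1+o⇒m+n≤o i room)))

  fillFrom-smaller-W : ∀ i → i < a →
    fillFrom smaller K (3 + i) (W ∷ []) (afterSecondS i)
      ≡ (1 ∷ range 2 i ++ 3 + i ∷ []) ∷ (2 + i ∷ []) ∷ [] ∷ []
  fillFrom-smaller-W i i<a = step-W-into-first smaller a c (3 + i) 1 (range 2 i) (2 + i) (lastEntry-range 1 i)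
    (subst (_< a) (sym (length-range 2 i)) i<a) (<⇒<ᵇ≡true (n<1+n (suc i)))

  fillFrom-smaller-Ws : ∀ i j → i + suc (suc j) ≤ suc a →
    fillFrom smaller K (3 + i) (replicate (suc (suc j)) W) (afterSecondS i)
      ≡ (1 ∷ range 2 i ++ 3 + i ∷ range (5 + i) j) ∷ (2 + i ∷ 4 + i ∷ []) ∷ [] ∷ []
  fillFrom-smaller-Ws i j room = begin
    fillFrom smaller K (5 + i) (replicate j W) (step smaller K (4 + i) W (step smaller K (3 + i) W (afterSecondS i)))
      ≡⟨ cong (λ cs → fillFrom smaller K (5 + i) (replicate j W) (step smaller K (4 + i) W cs))
              (fillFrom-smaller-W i (m+2+n≤1+o⇒m<o i room)) ⟩
    fillFrom smaller K (5 + i) (replicate j W) (step smaller K (4 + i) W ((1 ∷ X) ∷ (2 + i ∷ []) ∷ [] ∷ []))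
      ≡⟨ cong (fillFrom smaller K (5 + i) (replicate j W))
              (step-W-into-second smaller a c (4 + i) 1 X (2 + i) (lastEntry-snoc (1 ∷ range 2 i) (3 + i))
                                  (≤⇒<ᵇ≡false (n≤1+n (2 + i)))) ⟩
    fillFrom smaller K (5 + i) (replicate j W) ((1 ∷ X) ∷ (2 + i ∷ 4 + i ∷ []) ∷ [] ∷ [])
      ≡⟨ fillFrom-Ws-first-column smaller a (1 ∷ c ∷ []) (5 + i) j 1 X ((2 + i ∷ 4 + i ∷ []) ∷ [] ∷ []) refl
                                  room′ ⟩
    (1 ∷ X ++ range (5 + i) j) ∷ (2 + i ∷ 4 + i ∷ []) ∷ [] ∷ []
      ≡⟨ cong (λ c₁ → (1 ∷ c₁) ∷ (2 + i ∷ 4 + i ∷ []) ∷ [] ∷ [])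
              (++-assoc (range 2 i) (3 + i ∷ []) (range (5 + i) j)) ⟩
    (1 ∷ range 2 i ++ 3 + i ∷ range (5 + i) j) ∷ (2 + i ∷ 4 + i ∷ []) ∷ [] ∷ [] ∎
    where
    open ≡-Reasoning
    X = range 2 i ++ 3 + i ∷ []
    room′ : length X + j ≤ a
    room′ = subst (_≤ a) (sym (begin
      length X + j                  ≡⟨ cong (_+ j) (length-++ (range 2 i)) ⟩
      length (range 2 i) + 1 + j    ≡⟨ cong (λ n → n + 1 + j) (length-range 2 i) ⟩
      i + 1 + j                     ≡⟨ +-assoc i 1 j ⟩
      i + suc j                     ∎)) (m+1+n≤1+o⇒m+n≤o i room)

  rankIn-before-second-top : ∀ i Z → rankIn (suc i) ((0 , 1 ∷ range 2 i ++ Z) ∷ []) ≡ just i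
  rankIn-before-second-top i Z =
    rankIn-here (suc i) 0 (range 1 (suc i) ++ Z) []
                (posIn-++-∈ˡ {suc i} (range 1 (suc i)) Z (posIn-range 1 (n<1+n i) refl))

  rankIn-first-column : ∀ i Z ds {q m} → 2 + i ≤ q → posIn q Z ≡ just m →
    rankIn q ((0 , 1 ∷ range 2 i ++ Z) ∷ ds) ≡ just (suc i + m)
  rankIn-first-column i Z ds {q} {m} q≥2+i q∈Z =
    trans (rankIn-here q 0 (range 1 (suc i) ++ Z) ds
                       (posIn-++-∉ˡ {q} (range 1 (suc i)) Z (range-∌ 1 (suc i) q≥2+i) q∈Z))
          (cong (λ n → just (n + m)) (length-range 1 (suc i)))

  rankIn-second-column : ∀ i Z Y {q} → 3 + i ≤ q → posIn q Z ≡ nothing →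
    rankIn q ((0 , 1 ∷ range 2 i ++ Z) ∷ (i , 2 + i ∷ q ∷ Y) ∷ []) ≡ just (suc i)
  rankIn-second-column i Z Y {q} q≥3+i q∉Z = begin
    rankIn q ((0 , range 1 (suc i) ++ Z) ∷ (i , 2 + i ∷ q ∷ Y) ∷ [])
      ≡⟨ rankIn-there q 0 _ _ (trans (posIn-++-∉ʳ (range 1 (suc i)) Z q∉Z)
                                     (posIn-∉ (range 1 (suc i)) (range-∌ 1 (suc i) (≤-trans (n≤1+n _) q≥3+i)))) ⟩
    rankIn q ((i , 2 + i ∷ q ∷ Y) ∷ [])
      ≡⟨ rankIn-here q i _ [] (trans (posIn-≢ (q ∷ Y) (>⇒≢ q≥3+i)) (cong (Maybe.map suc) (posIn-≡ q Y))) ⟩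
    just (i + 1)
      ≡⟨ cong just (+-comm i 1) ⟩
    just (suc i) ∎
    where open ≡-Reasoning

  firstRowRanks-path : ∀ b i j ρ Z Y {r} → i ≤ a →
    fillFrom b K (3 + i) (replicate j W) (afterSecondS i) ≡ (1 ∷ range 2 i ++ Z) ∷ (2 + i ∷ Y) ∷ [] ∷ [] →
    rankIn (2 + i + j) ((0 , 1 ∷ range 2 i ++ Z) ∷ (i , 2 + i ∷ Y) ∷ []) ≡ just r →
    firstRowRanks (fill b K (path i j ρ)) ≡ 0 ∷ i ∷ r ∷ []
  firstRowRanks-path b i j ρ Z Y i≤a afterWs rank₃ =
    trans (firstRowRanks-fill b i j ρ _ Y i≤a afterWs)
          (trans (firstRowRanks-three 1 (range 2 i ++ Z) (2 + i) Y (3 + i + j) [] (rankIn-before-second-top i Z))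
                 (cong (λ r → 0 ∷ i ∷ fromMaybe 0 r ∷ []) rank₃))

  firstRowRanks-η* : ∀ i j ρ → i + suc j ≤ suc a →
    firstRowRanks (η* K (path i (suc j) ρ)) ≡ 0 ∷ i ∷ suc i + pred j ∷ []
  firstRowRanks-η* i j ρ room =
    firstRowRanks-path larger i (suc j) ρ _ _ (m+1+n≤1+o⇒m≤o i room) (fillFrom-larger-Ws i j room) (rank₃ j)
    where
    rank₃ : ∀ j → rankIn (2 + i + suc j) ((0 , 1 ∷ range 2 i ++ range (4 + i) j) ∷ (i , 2 + i ∷ 3 + i ∷ []) ∷ [])
                  ≡ just (suc i + pred j)
    rank₃ zero rewrite +-comm i 1 | +-identityʳ i = rankIn-second-column i [] [] ≤-refl refl
    rank₃ (suc m) = rankIn-first-column i (range (4 + i) (suc m)) _ (m≤m+n (2 + i) _)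
      (posIn-range (4 + i) (n<1+n m) (cong (2 +_) (trans (+-suc i (suc m)) (cong suc (+-suc i m)))))

  firstRowRanks-η : ∀ i j ρ → i < a → i + suc j ≤ suc a →
    firstRowRanks (η K (path i (suc j) ρ)) ≡ 0 ∷ i ∷ suc i + pred j ∷ []
  firstRowRanks-η i zero ρ i<a _ =
    firstRowRanks-path smaller i 1 ρ (3 + i ∷ []) [] (<⇒≤ i<a) (fillFrom-smaller-W i i<a) rank₃
    where
    rank₃ : rankIn (2 + i + 1) ((0 , 1 ∷ range 2 i ++ 3 + i ∷ []) ∷ (i , 2 + i ∷ []) ∷ []) ≡ just (suc i + 0)
    rank₃ rewrite +-comm i 1 = rankIn-first-column i (3 + i ∷ []) _ (n≤1+n _) (posIn-≡ (3 + i) [])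
  firstRowRanks-η i (suc j) ρ _ room =
    firstRowRanks-path smaller i (2 + j) ρ _ _ (m+1+n≤1+o⇒m≤o i room) (fillFrom-smaller-Ws i j room) (rank₃ j)
    where
    rank₃ : ∀ j → rankIn (2 + i + suc (suc j))
                         ((0 , 1 ∷ range 2 i ++ 3 + i ∷ range (5 + i) j) ∷ (i , 2 + i ∷ 4 + i ∷ []) ∷ [])
                  ≡ just (suc i + j)
    rank₃ zero rewrite +-suc i 1 | +-comm i 1 | +-identityʳ i =
      rankIn-second-column i (3 + i ∷ []) [] (n≤1+n _) (posIn-∉ (3 + i ∷ []) (>⇒≢ ≤-refl ∷ []))
    rank₃ (suc m) = rankIn-first-column i (3 + i ∷ range (5 + i) (suc m)) _ (m≤m+n (2 + i) _)
      (trans (posIn-≢ (range (5 + i) (suc m))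
                      (>⇒≢ (subst (3 + i <_) (sym q≡5+i+m) (≤-trans (n≤1+n _) (m≤m+n (5 + i) m)))))
             (cong (Maybe.map suc) (posIn-range (5 + i) (n<1+n m) q≡5+i+m)))
      where
      q≡5+i+m : 2 + i + suc (suc (suc m)) ≡ 5 + i + m
      q≡5+i+m = cong (2 +_) (trans (+-suc i (suc (suc m))) (cong suc (trans (+-suc i (suc m)) (cong suc (+-suc i m)))))

  firstRowRanks-same-prefix : ∀ i j ρ {X Y} → i ≤ a →
    (∀ b → fillFrom b K (3 + i) (replicate j W) (afterSecondS i) ≡ (1 ∷ X) ∷ (2 + i ∷ Y) ∷ [] ∷ []) →
    firstRowRanks (η* K (path i j ρ)) ≡ firstRowRanks (η K (path i j ρ))
  firstRowRanks-same-prefix i j ρ i≤a afterWs =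
    trans (firstRowRanks-fill larger i j ρ _ _ i≤a (afterWs larger))
          (sym (firstRowRanks-fill smaller i j ρ _ _ i≤a (afterWs smaller)))

  firstRowRanks-η*≡η : ∀ i j ρ → i ≤ a → i + j ≤ suc a →
    firstRowRanks (η* K (path i j ρ)) ≡ firstRowRanks (η K (path i j ρ))
  firstRowRanks-η*≡η i zero          ρ i≤a _    = firstRowRanks-same-prefix i 0 ρ i≤a (λ _ → refl)
  firstRowRanks-η*≡η i (suc zero)    ρ i≤a room with m≤n⇒m<n∨m≡n i≤a
  ... | inj₁ i<a  = trans (firstRowRanks-η* i 0 ρ room) (sym (firstRowRanks-η i 0 ρ i<a room))
  ... | inj₂ refl = firstRowRanks-same-prefix i 1 ρ i≤a fillFrom-W-full-first-column
  firstRowRanks-η*≡η i (suc (suc j)) ρ _   room =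
    trans (firstRowRanks-η* i (suc j) ρ room)
          (sym (firstRowRanks-η i (suc j) ρ (m+2+n≤1+o⇒m<o i room) room))

proposition5p6 : (a c : ℕ) → 1 ≤ a → 1 ≤ c →
    ((π : Word) → IsDyck (a ∷ 1 ∷ c ∷ []) π →
       depth (a ∷ 1 ∷ c ∷ []) π ≡ bounce (a ∷ 1 ∷ c ∷ []) π)
    × (gfDepth (a ∷ 1 ∷ c ∷ []) ≡ gfBounce (a ∷ 1 ∷ c ∷ []))
proposition5p6 a c _ _ =
  depth≡bounce , map-cong-local (All.map same-monomial (all-filter (isDyck? K) (allWords (sum K + length K))))
  where
  open Vector-a-1-c a c
  depth≡bounce : ∀ π → IsDyck K π → depth K π ≡ bounce K π
  depth≡bounce π π-Dyck with IsDyck⇒path π π-Dyck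
  ... | i , j , ρ , refl , i≤a , i+j≤1+a = cong sum (firstRowRanks-η*≡η i j ρ i≤a i+j≤1+a)
  same-monomial : ∀ {π} → IsDyck K π → (area K π , depth K π) ≡ (area K π , bounce K π)
  same-monomial {π} π-Dyck = cong (area K π ,_) (depth≡bounce π π-Dyck)
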